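{- Let $L$ be a residuated lattice, $n\geq 1$ an integer, and $F$ a filter of $L$. The following conditions are equivalent: (i) $F$ is an $n$-fold positive implicative filter of $L$; (ii) for all $x,y\in L$, if $(x^n\rightarrow y)\rightarrow x\in F$ then $x\in F$; (iii) for all $x\in L$, if $\overline{x^n}\rightarrow x\in F$ then $x\in F$.
   Context: A residuated lattice is an algebra $(L,\wedge,\vee,\otimes,\rightarrow,0,1)$ such that $(L,\wedge,\vee,0,1)$ is a bounded lattice, $(L,\otimes,1)$ is a commutative monoid, and $x\otimes y\leq z$ iff $x\leq y\rightarrow z$. A filter of $L$ is a nonempty subset closed under $\otimes$ and upward closed. For $x\in L$, $\overline{x}=x\rightarrow 0$ and $x^n=x\otimes\cdots\otimes x$ ($n$ factors). A subset $F\subseteq L$ is an $n$-fold positive implicative filter if $1\in F$ and for all $x,y,z\in L$: $x\rightarrow((y^n\rightarrow z)\rightarrow y)\in F$ and $x\in F$ imply $y\in F$. -}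

module Defs where

open import Level using (Level; _⊔_; suc)
open import Data.Nat using (ℕ; zero) renaming (suc to sucℕ)
open import Data.Product using (Σ; _×_)
open import Relation.Binary.PropositionalEquality using (_≡_)
open import Relation.Binary.Lattice using (IsBoundedLattice)
open import Algebra.Structures using (IsCommutativeMonoid)

record ResiduatedLattice (c ℓ : Level) : Set (suc (c ⊔ ℓ)) where
  infixr 5 _⇒_
  infixl 7 _⊗_
  infix 4 _≤_
  field
    Carrier : Set c
    _≤_ : Carrier → Carrier → Set ℓ
    _∧_ _∨_ _⊗_ _⇒_ : Carrier → Carrier → Carrier
    𝟘 𝟙 : Carrier
    isBoundedLattice : IsBoundedLattice _≡_ _≤_ _∨_ _∧_ 𝟙 𝟘
    ⊗-isCommutativeMonoid : IsCommutativeMonoid _≡_ _⊗_ 𝟙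
    residuation-to : ∀ {x y z} → x ⊗ y ≤ z → x ≤ y ⇒ z
    residuation-from : ∀ {x y z} → x ≤ y ⇒ z → x ⊗ y ≤ z

  ¬′ : Carrier → Carrier
  ¬′ x = x ⇒ 𝟘

  _^_ : Carrier → ℕ → Carrier
  x ^ zero = 𝟙
  x ^ sucℕ n = x ⊗ (x ^ n)

module _ {c ℓ : Level} (L : ResiduatedLattice c ℓ) where
  open ResiduatedLattice L

  record IsFilter {p} (F : Carrier → Set p) : Set (c ⊔ ℓ ⊔ p) where
    field
      nonempty : Σ Carrier F
      ⊗-closed : ∀ {x y} → F x → F y → F (x ⊗ y)
      up-closed : ∀ {x y} → x ≤ y → F x → F y

  IsNFoldPIF : ∀ {p} → ℕ → (Carrier → Set p) → Set (c ⊔ p)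
  IsNFoldPIF n F =
    F 𝟙 × (∀ x y z → F (x ⇒ (((y ^ n) ⇒ z) ⇒ y)) → F x → F y)

module Submission where

open import Defs
open import Level using (Level)
open import Data.Nat using (ℕ; _≥_)
open import Data.Product using (_×_; _,_)
open import Function.Bundles using (_⇔_; mk⇔)
open import Relation.Binary.PropositionalEquality using (subst; subst₂; sym)
open import Relation.Binary.Lattice using (IsBoundedLattice)
open import Algebra.Structures using (IsCommutativeMonoid)

module ResiduatedLatticeProperties {c ℓ : Level} (L : ResiduatedLattice c ℓ) where
  open ResiduatedLattice L
  open IsBoundedLattice isBoundedLattice using (refl; trans)
  open IsCommutativeMonoid ⊗-isCommutativeMonoid using (comm; identityʳ)

  ⇒-modusPonens : ∀ {x y} → (x ⇒ y) ⊗ x ≤ y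
  ⇒-modusPonens = residuation-from refl

  ⊗-monoˡ-≤ : ∀ {x y z} → x ≤ y → x ⊗ z ≤ y ⊗ z
  ⊗-monoˡ-≤ x≤y = residuation-from (trans x≤y (residuation-to refl))

  ⊗-monoʳ-≤ : ∀ {x y z} → x ≤ y → z ⊗ x ≤ z ⊗ y
  ⊗-monoʳ-≤ {x} {y} {z} x≤y = subst₂ _≤_ (comm x z) (comm y z) (⊗-monoˡ-≤ x≤y)

  ⇒-monoʳ-≤ : ∀ {x y z} → x ≤ y → z ⇒ x ≤ z ⇒ y
  ⇒-monoʳ-≤ x≤y = residuation-to (trans ⇒-modusPonens x≤y)

  ⇒-antiˡ-≤ : ∀ {x y z} → x ≤ y → y ⇒ z ≤ x ⇒ z
  ⇒-antiˡ-≤ x≤y = residuation-to (trans (⊗-monoʳ-≤ x≤y) ⇒-modusPonens)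

  ≤-𝟙⇒ : ∀ {x} → x ≤ 𝟙 ⇒ x
  ≤-𝟙⇒ {x} = residuation-to (subst (_≤ x) (sym (identityʳ x)) refl)

module FilterProperties {c ℓ p : Level} (L : ResiduatedLattice c ℓ)
                        {F : ResiduatedLattice.Carrier L → Set p} (isF : IsFilter L F) where
  open ResiduatedLattice L
  open ResiduatedLatticeProperties L
  open IsFilter isF
  open IsBoundedLattice isBoundedLattice using (maximum)

  𝟙∈F : F 𝟙
  𝟙∈F with (x , x∈F) ← nonempty = up-closed (maximum x) x∈F

  ⇒-closed : ∀ {x y} → F (x ⇒ y) → F x → F y
  ⇒-closed x⇒y∈F x∈F = up-closed ⇒-modusPonens (⊗-closed x⇒y∈F x∈F)

proposition5p4 : ∀ {c ℓ p : Level} (L : ResiduatedLattice c ℓ) (n : ℕ) → n ≥ 1 →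
    (F : ResiduatedLattice.Carrier L → Set p) → IsFilter L F →
    let open ResiduatedLattice L in
    (IsNFoldPIF L n F ⇔ (∀ x y → F (((x ^ n) ⇒ y) ⇒ x) → F x))
    × ((∀ x y → F (((x ^ n) ⇒ y) ⇒ x) → F x) ⇔ (∀ x → F (¬′ (x ^ n) ⇒ x) → F x))
proposition5p4 L n _ F isF = mk⇔ i⇒ii ii⇒i , mk⇔ ii⇒iii iii⇒ii
  where
  open ResiduatedLattice L
  open ResiduatedLatticeProperties L
  open FilterProperties L isF
  open IsFilter isF using (up-closed)
  open IsBoundedLattice isBoundedLattice using (minimum)

  i⇒ii : IsNFoldPIF L n F → ∀ x y → F (((x ^ n) ⇒ y) ⇒ x) → F x
  i⇒ii (_ , pif) x y a∈F = pif 𝟙 x y (up-closed ≤-𝟙⇒ a∈F) 𝟙∈F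

  ii⇒i : (∀ x y → F (((x ^ n) ⇒ y) ⇒ x) → F x) → IsNFoldPIF L n F
  ii⇒i h = 𝟙∈F , λ x y z x⇒a∈F x∈F → h y z (⇒-closed x⇒a∈F x∈F)

  ii⇒iii : (∀ x y → F (((x ^ n) ⇒ y) ⇒ x) → F x) → ∀ x → F (¬′ (x ^ n) ⇒ x) → F x
  ii⇒iii h x = h x 𝟘

  -- 0 ≤ y gives ¬′ (x ^ n) ≤ x ^ n ⇒ y, hence ((x ^ n) ⇒ y) ⇒ x ≤ ¬′ (x ^ n) ⇒ x.
  iii⇒ii : (∀ x → F (¬′ (x ^ n) ⇒ x) → F x) → ∀ x y → F (((x ^ n) ⇒ y) ⇒ x) → F x
  iii⇒ii h x y a∈F = h x (up-closed (⇒-antiˡ-≤ (⇒-monoʳ-≤ (minimum y))) a∈F)
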